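{- Let $G=(V,E)$ be a graph with $V=V_1\uplus\dots\uplus V_k$, where $V_i=\{v_{i,1},\dots,v_{i,|V_i|}\}$, and let $E_{i,j}$ be the set of edges between $V_i$ and $V_j$. For each $i\in[k]$ let $X_i=\{x_{i,a}: v_{i,a}\in V_i\}$ be a set of Boolean variables, and let $$\Phi=\bigwedge_{1\le i<j\le k}\ \bigvee_{\{v_{i,a},v_{j,b}\}\in E_{i,j}} \left(x_{i,a}\wedge x_{j,b}\right).$$ Then $G$ is a yes-instance of Multi-Colored Clique if and only if $((X_1,\dots,X_k),\Phi)$ is a yes-instance of Multi-Colored Positive SAT.
   Context: Multi-Colored Clique: given a graph $G=(V,E)$ with $V=V_1\uplus\dots\uplus V_k$, decide whether there is a set $C\subseteq V$ with $|C|=k$ such that every two distinct vertices of $C$ are adjacent. Multi-Colored Positive SAT: given pairwise disjoint sets of Boolean variables $X_1,\dots,X_n$ and a Boolean formula $\Phi$ over these variables built only from positive literals and the operators $\wedge$ and $\vee$, decide whether there is a truth assignment satisfying $\Phi$ in which exactly one variable of each $X_i$ is true. -}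

module Defs where

open import Data.Nat using (ℕ)
open import Data.Fin using (Fin; _<_; _<?_)
open import Data.Fin.Base using ()
open import Data.Bool using (Bool; true; false; _∧_; _∨_; if_then_else_)
open import Data.List using (List; []; _∷_; foldr; concatMap; allFin)
open import Data.Product using (Σ; ∃; ∃-syntax; _×_; _,_)
open import Relation.Nullary using (¬_; Dec; does)
open import Relation.Binary.PropositionalEquality using (_≡_)

-- Vertex / variable sets partitioned into k colour classes.
-- Class i has (sizes i) elements, indexed by Fin (sizes i):
-- element (i , a) stands for v_{i,a} (resp. x_{i,a}).

Elem : {k : ℕ} → (Fin k → ℕ) → Set
Elem {k} sizes = Σ (Fin k) (λ i → Fin (sizes i))

record Graph (V : Set) : Set₁ where
  field
    Adj    : V → V → Set
    sym    : ∀ {u v} → Adj u v → Adj v u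
    irrefl : ∀ {v} → ¬ Adj v v
    adj?   : ∀ u v → Dec (Adj u v)
open Graph public

MultiColoredClique : {k : ℕ} (sizes : Fin k → ℕ) → Graph (Elem sizes) → Set
MultiColoredClique {k} sizes G =
  Σ ((i : Fin k) → Fin (sizes i)) λ c →
    ∀ (i j : Fin k) → ¬ i ≡ j → Adj G (i , c i) (j , c j)

-- Positive Boolean formulas: only variables, ∧ and ∨.
-- The constants ⊤ᶠ / ⊥ᶠ serve only as the values of the empty
-- conjunction / disjunction (standard convention).

data PForm (X : Set) : Set where
  var   : X → PForm X
  _∧ᶠ_  : PForm X → PForm X → PForm X
  _∨ᶠ_  : PForm X → PForm X → PForm X
  ⊤ᶠ ⊥ᶠ : PForm X

⋀ : {X : Set} → List (PForm X) → PForm X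
⋀ = foldr _∧ᶠ_ ⊤ᶠ

⋁ : {X : Set} → List (PForm X) → PForm X
⋁ = foldr _∨ᶠ_ ⊥ᶠ

eval : {X : Set} → (X → Bool) → PForm X → Bool
eval β (var x)  = β x
eval β (φ ∧ᶠ ψ) = eval β φ ∧ eval β ψ
eval β (φ ∨ᶠ ψ) = eval β φ ∨ eval β ψ
eval β ⊤ᶠ       = true
eval β ⊥ᶠ       = false

-- Multi-Colored Positive SAT: variable sets X_1, ..., X_n (pairwise
-- disjoint; X_i = { (i , a) | a : Fin (sizes i) }) and a positive formula
-- Φ over them.

ExactlyOneTruePerClass : {n : ℕ} (sizes : Fin n → ℕ) → (Elem sizes → Bool) → Set
ExactlyOneTruePerClass {n} sizes β =
  ∀ (i : Fin n) → ∃[ a ] (β (i , a) ≡ true ×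
                          (∀ b → β (i , b) ≡ true → b ≡ a))

MultiColoredPositiveSAT : {n : ℕ} (sizes : Fin n → ℕ) → PForm (Elem sizes) → Set
MultiColoredPositiveSAT sizes Φ =
  ∃[ β ] (ExactlyOneTruePerClass sizes β × eval β Φ ≡ true)

edgeDisj : {k : ℕ} (sizes : Fin k → ℕ) → Graph (Elem sizes) →
           (i j : Fin k) → PForm (Elem sizes)
edgeDisj sizes G i j =
  ⋁ (concatMap (λ a → concatMap (λ b →
        if does (adj? G (i , a) (j , b))
        then ((var (i , a) ∧ᶠ var (j , b)) ∷ [])
        else [])
      (allFin (sizes j)))
    (allFin (sizes i)))

reductionΦ : {k : ℕ} (sizes : Fin k → ℕ) → Graph (Elem sizes) → PForm (Elem sizes)
reductionΦ {k} sizes G =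
  ⋀ (concatMap (λ i → concatMap (λ j →
        if does (i <? j) then (edgeDisj sizes G i j ∷ []) else [])
      (allFin k))
    (allFin k))

-- A satisfying assignment with exactly one true variable per class is the
-- same thing as a choice of one vertex per class.  Under that reading, the
-- clause for i < j holds exactly when the chosen vertices of V_i and V_j are
-- adjacent, and since adjacency is symmetric the clauses for i < j already
-- cover every pair of distinct classes.
module Submission where

open import Defs
open import Data.Nat using (ℕ)
open import Data.Fin using (Fin; _<_; _<?_; _≟_)
open import Data.Fin.Properties using (<-cmp; <⇒≢)
open import Data.Bool using (Bool; true; false; _∧_; _∨_; if_then_else_)
open import Data.List using (List; []; _∷_; concatMap; allFin)
open import Data.List.Relation.Unary.All as All using (All; []; _∷_)
open import Data.List.Relation.Unary.Any as Any using (Any; here; there)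
open import Data.List.Membership.Propositional using (_∈_; find; lose)
open import Data.List.Membership.Propositional.Properties
  using (∈-concatMap⁺; ∈-concatMap⁻; ∈-allFin)
open import Data.Product using (_×_; _,_; proj₁; proj₂; ∃-syntax; ∃₂)
open import Data.Sum as Sum using (_⊎_; inj₁; inj₂)
open import Data.Empty using (⊥-elim)
open import Function using (id; _∘_)
open import Function.Bundles using (_⇔_; mk⇔; Equivalence)
open import Relation.Nullary using (¬_; Dec; does; yes; no)
open import Relation.Nullary.Decidable using (dec-true)
open import Relation.Binary using (tri<; tri≈; tri>)
open import Relation.Binary.PropositionalEquality using (_≡_; refl; subst₂)

open Equivalence using (to; from)

∧≡true : ∀ {x y} → x ∧ y ≡ true ⇔ (x ≡ true × y ≡ true)
∧≡true {true}  = mk⇔ (refl ,_) proj₂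
∧≡true {false} = mk⇔ (λ ()) (λ { (() , _) })

∨≡true : ∀ {x y} → x ∨ y ≡ true ⇔ (x ≡ true ⊎ y ≡ true)
∨≡true {true}  = mk⇔ (λ _ → inj₁ refl) (λ _ → refl)
∨≡true {false} = mk⇔ inj₂ (Sum.[ (λ ()) , id ])

_⊨_ : {X : Set} → (X → Bool) → PForm X → Set
β ⊨ φ = eval β φ ≡ true

module _ {X : Set} {β : X → Bool} where

  ⊨-⋀ : ∀ {φs} → β ⊨ ⋀ φs ⇔ All (β ⊨_) φs
  ⊨-⋀ {[]}     = mk⇔ (λ _ → []) (λ _ → refl)
  ⊨-⋀ {φ ∷ φs} = mk⇔
    (λ sat → let sat₁ , sat₂ = to (∧≡true {eval β φ}) sat in sat₁ ∷ to ⊨-⋀ sat₂)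
    (λ { (sat₁ ∷ sat₂) → from ∧≡true (sat₁ , from ⊨-⋀ sat₂) })

  ⊨-⋁ : ∀ {φs} → β ⊨ ⋁ φs ⇔ Any (β ⊨_) φs
  ⊨-⋁ {[]}     = mk⇔ (λ ()) (λ ())
  ⊨-⋁ {φ ∷ φs} = mk⇔
    (Any.fromSum ∘ Sum.map₂ (to ⊨-⋁) ∘ to (∨≡true {eval β φ}))
    (from ∨≡true ∘ Sum.map₂ (from ⊨-⋁) ∘ Any.toSum)

∈-concatMap-allFin : ∀ {A : Set} {n} {f : Fin n → List A} {y} →
                     y ∈ concatMap f (allFin n) ⇔ (∃[ i ] y ∈ f i)
∈-concatMap-allFin {n = n} {f} = mk⇔
  (λ y∈ → let i , _ , y∈fi = find (∈-concatMap⁻ f {xs = allFin n} y∈) in i , y∈fi)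
  (λ (i , y∈fi) → ∈-concatMap⁺ f (lose (∈-allFin i) y∈fi))

∈-if-singleton : ∀ {A P : Set} (P? : Dec P) {x y : A} →
                 x ∈ (if does P? then y ∷ [] else []) ⇔ (P × x ≡ y)
∈-if-singleton (yes p) = mk⇔ (λ { (here x≡y) → p , x≡y ; (there ()) }) (here ∘ proj₂)
∈-if-singleton (no ¬p) = mk⇔ (λ ()) (⊥-elim ∘ ¬p ∘ proj₁)

-- reductionΦ and edgeDisj are, definitionally, ⋀ and ⋁ of comprehensions.
comprehension : ∀ {A : Set} {m n} {P : Fin m → Fin n → Set} →
                (∀ a b → Dec (P a b)) → (Fin m → Fin n → A) → List A
comprehension {m = m} {n} P? φ =
  concatMap (λ a → concatMap (λ b → if does (P? a b) then φ a b ∷ [] else [])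
                             (allFin n))
            (allFin m)

module _ {A : Set} {m n} {P : Fin m → Fin n → Set}
         (P? : ∀ a b → Dec (P a b)) (φ : Fin m → Fin n → A) where

  ∈-comprehension : ∀ {x} → x ∈ comprehension P? φ ⇔ (∃₂ λ a b → P a b × x ≡ φ a b)
  ∈-comprehension = mk⇔
    (λ x∈ → let a , x∈a = to ∈-concatMap-allFin x∈
                b , x∈ab = to ∈-concatMap-allFin x∈a
            in a , b , to (∈-if-singleton (P? a b)) x∈ab)
    (λ (a , b , x∈ab) → from ∈-concatMap-allFin
      (a , from ∈-concatMap-allFin (b , from (∈-if-singleton (P? a b)) x∈ab)))

module _ {X : Set} {β : X → Bool} {m n} {P : Fin m → Fin n → Set}
         (P? : ∀ a b → Dec (P a b)) (φ : Fin m → Fin n → PForm X) where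

  ⊨-⋀-comprehension : β ⊨ ⋀ (comprehension P? φ) ⇔ (∀ a b → P a b → β ⊨ φ a b)
  ⊨-⋀-comprehension = mk⇔
    (λ sat a b pab → All.lookup (to (⊨-⋀ {φs = comprehension P? φ}) sat)
                                (from (∈-comprehension P? φ) (a , b , pab , refl)))
    (λ sat → from ⊨-⋀ (All.tabulate λ ψ∈ → case-∈ (to (∈-comprehension P? φ) ψ∈) sat))
    where
    case-∈ : ∀ {ψ} → ∃₂ (λ a b → P a b × ψ ≡ φ a b) →
             (∀ a b → P a b → β ⊨ φ a b) → β ⊨ ψ
    case-∈ (a , b , pab , refl) sat = sat a b pab

  ⊨-⋁-comprehension : β ⊨ ⋁ (comprehension P? φ) ⇔ (∃₂ λ a b → P a b × β ⊨ φ a b)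
  ⊨-⋁-comprehension = mk⇔
    (λ sat → let ψ , ψ∈ , satψ = find (to (⊨-⋁ {φs = comprehension P? φ}) sat) in
             witness (to (∈-comprehension P? φ) ψ∈) satψ)
    (λ (a , b , pab , sat) →
      from ⊨-⋁ (lose (from (∈-comprehension P? φ) (a , b , pab , refl)) sat))
    where
    witness : ∀ {ψ} → ∃₂ (λ a b → P a b × ψ ≡ φ a b) → β ⊨ ψ →
              ∃₂ λ a b → P a b × β ⊨ φ a b
    witness (a , b , pab , refl) sat = a , b , pab , sat

pairwise-<⇒pairwise-≢ : ∀ {k} {R : Fin k → Fin k → Set} → (∀ {i j} → R i j → R j i) →
                        (∀ i j → i < j → R i j) → ∀ i j → ¬ i ≡ j → R i j
pairwise-<⇒pairwise-≢ sym R< i j i≢j with <-cmp i j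
... | tri< i<j _ _ = R< i j i<j
... | tri≈ _ i≡j _ = ⊥-elim (i≢j i≡j)
... | tri> _ _ j<i = sym (R< j i j<i)

module _ {k : ℕ} {sizes : Fin k → ℕ} where

  indicator : ((i : Fin k) → Fin (sizes i)) → Elem sizes → Bool
  indicator c (i , a) = does (a ≟ c i)

  indicator-exactlyOne : ∀ c → ExactlyOneTruePerClass sizes (indicator c)
  indicator-exactlyOne c i = c i , dec-true (c i ≟ c i) refl , chosen
    where
    chosen : ∀ b → indicator c (i , b) ≡ true → b ≡ c i
    chosen b _  with b ≟ c i
    chosen b _  | yes b≡ci = b≡ci
    chosen b () | no _

  ⊨-reductionΦ : ∀ (G : Graph (Elem sizes)) {β} →
    β ⊨ reductionΦ sizes G ⇔
    (∀ i j → i < j → ∃₂ λ a b → Adj G (i , a) (j , b) × β (i , a) ≡ true × β (j , b) ≡ true)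
  ⊨-reductionΦ G {β} = mk⇔
    (λ sat i j i<j →
      let a , b , adj , satab = to (⊨-⋁-comprehension (edge? i j) (literals i j))
                                   (to (⊨-⋀-comprehension _<?_ (edgeDisj sizes G)) sat i j i<j)
      in a , b , adj , to (∧≡true {β (i , a)}) satab)
    (λ adj → from (⊨-⋀-comprehension _<?_ (edgeDisj sizes G)) λ i j i<j →
      let a , b , adjab , βa , βb = adj i j i<j
      in from (⊨-⋁-comprehension (edge? i j) (literals i j))
              (a , b , adjab , from ∧≡true (βa , βb)))
    where
    edge? : ∀ i j a b → Dec (Adj G (i , a) (j , b))
    edge? i j a b = adj? G (i , a) (j , b)
    literals : ∀ i j → Fin (sizes i) → Fin (sizes j) → PForm (Elem sizes)
    literals i j a b = var (i , a) ∧ᶠ var (j , b)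

lemma17 : (k : ℕ) (sizes : Fin k → ℕ) (G : Graph (Elem sizes)) →
    MultiColoredClique sizes G ⇔ MultiColoredPositiveSAT sizes (reductionΦ sizes G)
lemma17 k sizes G = mk⇔ clique⇒sat sat⇒clique
  where
  clique⇒sat : MultiColoredClique sizes G → MultiColoredPositiveSAT sizes (reductionΦ sizes G)
  clique⇒sat (c , clique) =
    indicator c , indicator-exactlyOne c , from (⊨-reductionΦ G) λ i j i<j →
      let _ , βci , _ = indicator-exactlyOne c i
          _ , βcj , _ = indicator-exactlyOne c j
      in c i , c j , clique i j (<⇒≢ i<j) , βci , βcj

  sat⇒clique : MultiColoredPositiveSAT sizes (reductionΦ sizes G) → MultiColoredClique sizes G
  sat⇒clique (β , exactlyOne , sat) =
    c , pairwise-<⇒pairwise-≢ (Graph.sym G) λ i j i<j →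
      let a , b , adj , βa , βb = to (⊨-reductionΦ G) sat i j i<j
      in subst₂ (λ a b → Adj G (i , a) (j , b)) (unique i a βa) (unique j b βb) adj
    where
    c : (i : Fin k) → Fin (sizes i)
    c i = proj₁ (exactlyOne i)
    unique : ∀ i a → β (i , a) ≡ true → a ≡ c i
    unique i = proj₂ (proj₂ (exactlyOne i))
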